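{- Let $\mathbf{u}=\lim_{k\to\infty}\varphi^k(0)$ be a Parry word with associated constant $R$, and let $F_j=|\varphi^j(0)|$. Let $Q\in\mathbb{N}$ have normal $F$-representation $\langle Q\rangle_F$ with $K$ digits, let $k\ge1$, and let $n$ be the integer with $\langle n\rangle_F=(\langle Q\rangle_F,0,\dots,0)$ ($k$ zeros appended), i.e. $n=\sum_j d_jF_{j+k}$ where $Q=\sum_j d_jF_j$. Let $\mathcal{Z}$ be an abelian co-decomposition of $\binom{\varphi^{K+R}(0)}{\mathbf{u}_{[Q]}^{ -1}\varphi^{K+R}(0)\mathbf{u}_{[Q]}}$. Then for any choice of abelian co-decompositions $D_{(z,\tilde z)}$ of the pairs $\binom{\varphi^k(z)}{\varphi^k(\tilde z)}$, $\binom{z}{\tilde z}\in\mathcal{Z}$, the set $\bigcup_{\binom{z}{\tilde z}\in\mathcal{Z}}D_{(z,\tilde z)}$ is an abelian co-decomposition of $\binom{\varphi^{k+K+R}(0)}{\mathbf{u}_{[n]}^{ -1}\varphi^{k+K+R}(0)\mathbf{u}_{[n]}}$.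
   Context: A Parry word is the fixed point $\mathbf{u}=\lim_k\varphi^k(0)$ of a substitution of one of two types. Simple type ($m\ge1$): alphabet $\{0,\dots,m-1\}$, $\varphi(\ell)=0^{\alpha_\ell}(\ell+1)$ for $\ell\le m-2$, $\varphi(m-1)=0^{\alpha_{m-1}}$, with $\alpha_{m-1}\ge1$, $\alpha_i\cdots\alpha_{m-1}0^\omega<_{\mathrm{lex}}\alpha_0\cdots\alpha_{m-1}0^\omega$ for $1\le i\le m-1$, some image of length $>1$. Non-simple type ($m,p\ge1$): alphabet $\{0,\dots,m+p-1\}$, $\varphi(\ell)=0^{\alpha_\ell}(\ell+1)$ for $\ell\le m+p-2$, $\varphi(m+p-1)=0^{\alpha_{m+p-1}}m$, with $d=\alpha_0\cdots\alpha_{m-1}(\alpha_m\cdots\alpha_{m+p-1})^\omega$ not ending in $0^\omega$, $m,p$ minimal, every shift $\alpha_i\alpha_{i+1}\cdots$ ($i\ge1$) lexicographically strictly smaller than $d$. Associated constant: simple type $R=m-1$ if $\alpha_0\ge2$, $R=m+\ell'-1$ with $\ell'=\min\{\ell\ge1:\alpha_\ell\ge1\}$ if $\alpha_0=1$; non-simple type, with $h'=\min\{\ell\ge m:\alpha_\ell\ge1\}$, $R=h'+p$ if $\alpha_0\ge2$, $R=h'+m+p-1$ if $\alpha_0=1$. Normal $F$-representation: digits $(d_N,\dots,d_0)$ with $n=\sum d_iF_i$ from the greedy algorithm (choose $N$ with $n<F_{N+1}$, $x_N=n$, $d_i=\lfloor x_i/F_i\rfloor$, $x_{i-1}=x_i-d_iF_i$),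 leading zeros allowed. $\mathbf{u}_{[n]}$ is the prefix of length $n$; $x^{ -1}(xv)=v$. Parikh vector $\Psi(w)=(|w|_\ell)_\ell$. Abelian co-decomposition of $\binom{v}{w}$ with $\Psi(v)=\Psi(w)$: the set of pairs $\{\binom{z_j}{\tilde z_j}\}_{j=0}^h$ from factorizations $v=z_0\cdots z_h$, $w=\tilde z_0\cdots\tilde z_h$ into nonempty factors with $\Psi(z_j)=\Psi(\tilde z_j)$. -}

module Defs where

open import Data.Nat using (ℕ; zero; suc; _+_; _*_; _∸_; _^_; _≤_; _<_; _<?_; _≟_)
open import Data.Nat.DivMod using (_/_; _%_)
open import Data.List using (List; []; _∷_; _++_; [_]; replicate; concatMap; concat; map; length; take; drop; filter)
open import Data.List.Membership.Propositional using (_∈_)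
open import Data.List.Relation.Unary.All using (All)
open import Data.Product using (Σ; ∃; ∃-syntax; _×_; _,_; proj₁; proj₂)
open import Data.Sum using (_⊎_)
open import Relation.Nullary using (¬_; yes; no)
open import Relation.Binary.PropositionalEquality using (_≡_)
open import Function using (_∘_)

-- Words over the alphabet ℕ (letters used: 0 .. size-1)

Word : Set
Word = List ℕ

-- Shape of a Parry substitution:
--   simple m        : alphabet {0..m-1}, φ(m-1) = 0^{α_{m-1}}
--   nonSimple m p   : alphabet {0..m+p-1}, φ(m+p-1) = 0^{α_{m+p-1}} m
data Shape : Set where
  simple    : ℕ → Shape
  nonSimple : ℕ → ℕ → Shape

size : Shape → ℕ
size (simple m)      = m
size (nonSimple m p) = m + p

lastTail : Shape → Word
lastTail (simple m)      = []
lastTail (nonSimple m p) = [ m ]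

-- The substitution on letters; α ℓ is the exponent α_ℓ (only ℓ < size matters).
φ : Shape → (ℕ → ℕ) → ℕ → Word
φ sh α ℓ with suc ℓ <? size sh
... | yes _ = replicate (α ℓ) 0 ++ [ suc ℓ ]
... | no  _ = replicate (α ℓ) 0 ++ lastTail sh

φw : Shape → (ℕ → ℕ) → Word → Word
φw sh α = concatMap (φ sh α)

φ^ : Shape → (ℕ → ℕ) → ℕ → Word → Word
φ^ sh α zero    w = w
φ^ sh α (suc j) w = φw sh α (φ^ sh α j w)

F : Shape → (ℕ → ℕ) → ℕ → ℕ
F sh α j = length (φ^ sh α j [ 0 ])

-- Prefix of length n of the fixed point u = lim φ^k(0).
-- (|φ^n(0)| ≥ n+1 for every Parry substitution, so this is u_[n].)
uPrefix : Shape → (ℕ → ℕ) → ℕ → Word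
uPrefix sh α n = take n (φ^ sh α n [ 0 ])

-- Left quotient x^{-1} v (used only when x is a prefix of v).
leftQuot : Word → Word → Word
leftQuot x v = drop (length x) v

LexLess : (ℕ → ℕ) → (ℕ → ℕ) → Set
LexLess a b = ∃[ j ] ((∀ i → i < j → a i ≡ b i) × a j < b j)

shiftSeq : ℕ → (ℕ → ℕ) → (ℕ → ℕ)
shiftSeq i s j = s (i + j)

finSeq : ℕ → (ℕ → ℕ) → ℕ → ℕ
finSeq m α i with i <? m
... | yes _ = α i
... | no  _ = 0

modN : ℕ → ℕ → ℕ
modN x zero    = 0
modN x (suc p) = x % suc p

perSeq : ℕ → ℕ → (ℕ → ℕ) → ℕ → ℕ
perSeq m p α i with i <? m
... | yes _ = α i
... | no  _ = α (m + modN (i ∸ m) p)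

EventuallyZero : (ℕ → ℕ) → Set
EventuallyZero d = ∃[ N ] (∀ i → N ≤ i → d i ≡ 0)

MinimalPrePeriod : ℕ → ℕ → (ℕ → ℕ) → Set
MinimalPrePeriod m p d =
  ∀ m' p' → 1 ≤ m' → 1 ≤ p' → (∀ i → m' ≤ i → d (i + p') ≡ d i) → m ≤ m' × p ≤ p'

IsParry : Shape → (ℕ → ℕ) → Set
IsParry (simple m) α =
  1 ≤ m × 1 ≤ α (m ∸ 1)
  × (∀ i → 1 ≤ i → i ≤ m ∸ 1 → LexLess (shiftSeq i (finSeq m α)) (finSeq m α))
  × (∃[ ℓ ] (ℓ < m × 1 < length (φ (simple m) α ℓ)))
IsParry (nonSimple m p) α =
  1 ≤ m × 1 ≤ p
  × ¬ EventuallyZero (perSeq m p α)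
  × MinimalPrePeriod m p (perSeq m p α)
  × (∀ i → 1 ≤ i → LexLess (shiftSeq i (perSeq m p α)) (perSeq m p α))

IsMin : (ℕ → Set) → ℕ → Set
IsMin P x = P x × (∀ y → P y → x ≤ y)

AssocConst : Shape → (ℕ → ℕ) → ℕ → Set
AssocConst (simple m) α R =
  (2 ≤ α 0 × R ≡ m ∸ 1)
  ⊎ (α 0 ≡ 1 × ∃[ ℓ' ] (IsMin (λ ℓ → 1 ≤ ℓ × ℓ < m × 1 ≤ α ℓ) ℓ' × R ≡ m + ℓ' ∸ 1))
AssocConst (nonSimple m p) α R =
  ∃[ h' ] (IsMin (λ ℓ → m ≤ ℓ × ℓ < m + p × 1 ≤ α ℓ) h'
    × ((2 ≤ α 0 × R ≡ h' + p) ⊎ (α 0 ≡ 1 × R ≡ h' + m + p ∸ 1)))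

divN : ℕ → ℕ → ℕ
divN x zero    = 0
divN x (suc y) = x / suc y

-- greedy sh α N x = digits (d_N , … , d_0) of x (most significant first)
greedy : Shape → (ℕ → ℕ) → ℕ → ℕ → List ℕ
greedy sh α zero    x = [ divN x (F sh α 0) ]
greedy sh α (suc N) x =
  divN x (F sh α (suc N)) ∷ greedy sh α N (x ∸ divN x (F sh α (suc N)) * F sh α (suc N))

valueShift : Shape → (ℕ → ℕ) → ℕ → List ℕ → ℕ
valueShift sh α k []       = 0
valueShift sh α k (d ∷ ds) = d * F sh α (length ds + k) + valueShift sh α k ds

Parikh : Word → ℕ → ℕ
Parikh w ℓ = length (filter (ℓ ≟_) w)

SameParikh : Word → Word → Set
SameParikh v w = ∀ ℓ → Parikh v ℓ ≡ Parikh w ℓ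

NonEmptyW : Word → Set
NonEmptyW w = 1 ≤ length w

IsCoDec : Word → Word → List (Word × Word) → Set
IsCoDec v w Z =
  1 ≤ length Z
  × All (λ pr → NonEmptyW (proj₁ pr) × NonEmptyW (proj₂ pr) × SameParikh (proj₁ pr) (proj₂ pr)) Z
  × concat (map proj₁ Z) ≡ v
  × concat (map proj₂ Z) ≡ w

-- Let X = φ^M(0), M = N + 1 + R, and P = u_[Q].  As u_[Q] is a prefix of X we
-- have X = P Y, and the given pair is (P Y , Y P).  Since φ^k is a monoid
-- morphism, refining the image of a co-decomposition of (P Y , Y P) pairwise
-- gives one of (φ^k(P) φ^k(Y) , φ^k(Y) φ^k(P)); so it suffices that φ^k(P) = u_[n].
-- That is the arithmetic heart: for a Parry substitution u_[Q] (Q < F_(N+1)) is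
-- the greedy word φ^N(0)^(d_N) ⋯ φ^0(0)^(d_0), whose image has length Σ d_j F_(j+k) = n.

module Submission where

open import Defs
open import Data.Nat using (ℕ; zero; suc; _+_; _*_; _∸_; _≤_; _<_; _<?_; z≤n; s≤s)
open import Data.Nat.Properties
open import Data.Nat.DivMod using (_/_; _%_; m≡m%n+[m/n]*n; [m+kn]%n≡m%n; m<n⇒m%n≡m; n%n≡0; m/n*n≤m; m%n≡m∸m/n*n; m%n<n; +-distrib-/-∣ʳ; m<n⇒m/n≡0; m*n/n≡m)
open import Data.Nat.Divisibility using (n∣m*n)
open import Data.List using (List; []; _∷_; _++_; [_]; replicate; concatMap; concat; map; length; take; drop)
open import Data.List.Properties using (length-++; ++-assoc; ++-identityʳ; take++drop≡id; map-++; concat-++; concatMap-++)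
open import Data.List.Relation.Unary.All using (All; []; _∷_)
open import Data.List.Relation.Unary.All.Properties using (++⁺)
open import Data.List.Relation.Unary.Any using (here; there)
open import Data.List.Membership.Propositional using (_∈_)
open import Data.Product using (∃-syntax; _×_; _,_; proj₁; proj₂)
open import Data.Sum using (_⊎_; inj₁; inj₂)
open import Data.Unit using (⊤; tt)
open import Relation.Nullary using (¬_; Dec; yes; no; contradiction)
open import Relation.Binary.Definitions using (tri<; tri≈; tri>)
open import Function using (_∘_)
open import Relation.Binary.PropositionalEquality
  using (_≡_; refl; sym; trans; cong; cong₂; subst; subst₂; module ≡-Reasoning)

module _ {A : Set} where

  take-length-++ : (xs ys : List A) → take (length xs) (xs ++ ys) ≡ xs
  take-length-++ []       ys = refl
  take-length-++ (x ∷ xs) ys = cong (x ∷_) (take-length-++ xs ys)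

  drop-length-++ : (xs ys : List A) → drop (length xs) (xs ++ ys) ≡ ys
  drop-length-++ []       ys = refl
  drop-length-++ (x ∷ xs) ys = drop-length-++ xs ys

  take-++-≤ : (xs ys : List A) (r : ℕ) → r ≤ length xs → take r (xs ++ ys) ≡ take r xs
  take-++-≤ xs       ys zero    _         = refl
  take-++-≤ (x ∷ xs) ys (suc r) (s≤s r≤) = cong (x ∷_) (take-++-≤ xs ys r r≤)

  take-++-+ : (xs ys : List A) (r : ℕ) → take (length xs + r) (xs ++ ys) ≡ xs ++ take r ys
  take-++-+ []       ys r = refl
  take-++-+ (x ∷ xs) ys r = cong (x ∷_) (take-++-+ xs ys r)

  pow : ℕ → List A → List A
  pow c w = concat (replicate c w)

  length-pow : ∀ c (w : List A) → length (pow c w) ≡ c * length w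
  length-pow zero    w = refl
  length-pow (suc c) w = trans (length-++ w) (cong (length w +_) (length-pow c w))

  pow-+ : ∀ a b (w : List A) → pow (a + b) w ≡ pow a w ++ pow b w
  pow-+ zero    b w = refl
  pow-+ (suc a) b w = trans (cong (w ++_) (pow-+ a b w)) (sym (++-assoc w _ _))

  take-pow-++ : ∀ d (w t : List A) r → take (d * length w + r) (pow d w ++ t) ≡ pow d w ++ take r t
  take-pow-++ zero    w t r = refl
  take-pow-++ (suc d) w t r = begin
    take ((length w + d * length w) + r) ((w ++ pow d w) ++ t)
      ≡⟨ cong₂ take (+-assoc (length w) (d * length w) r) (++-assoc w _ t) ⟩
    take (length w + (d * length w + r)) (w ++ (pow d w ++ t))
      ≡⟨ take-++-+ w _ _ ⟩
    w ++ take (d * length w + r) (pow d w ++ t)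
      ≡⟨ cong (w ++_) (take-pow-++ d w t r) ⟩
    w ++ (pow d w ++ take r t)
      ≡⟨ ++-assoc w _ _ ⟨
    (w ++ pow d w) ++ take r t ∎
    where open ≡-Reasoning

  take-pow-inside : ∀ a d (w t : List A) r → d < a → r ≤ length w
    → take (d * length w + r) (pow a w ++ t) ≡ pow d w ++ take r w
  take-pow-inside a d w t r d<a r≤ = begin
    take (d * length w + r) (pow a w ++ t)
      ≡⟨ cong (λ c → take (d * length w + r) (pow c w ++ t)) a≡ ⟩
    take (d * length w + r) (pow (d + suc e) w ++ t)
      ≡⟨ cong (take (d * length w + r)) (trans (cong (_++ t) (pow-+ d (suc e) w)) (++-assoc (pow d w) _ t)) ⟩
    take (d * length w + r) (pow d w ++ (w ++ pow e w) ++ t)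
      ≡⟨ take-pow-++ d w _ r ⟩
    pow d w ++ take r ((w ++ pow e w) ++ t)
      ≡⟨ cong (λ s → pow d w ++ take r s) (++-assoc w (pow e w) t) ⟩
    pow d w ++ take r (w ++ pow e w ++ t)
      ≡⟨ cong (pow d w ++_) (take-++-≤ w _ r r≤) ⟩
    pow d w ++ take r w ∎
    where
    open ≡-Reasoning
    e = a ∸ suc d
    a≡ : a ≡ d + suc e
    a≡ = sym (trans (+-suc d e) (m+[n∸m]≡n d<a))

  leftQuot-rotate : (p y : List A) → drop (length p) ((p ++ y) ++ p) ≡ y ++ p
  leftQuot-rotate p y = trans (cong (drop (length p)) (++-assoc p y p)) (drop-length-++ p (y ++ p))

divN-split : ∀ x f → 1 ≤ f → x ≡ divN x f * f + (x ∸ divN x f * f)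
divN-split x (suc f) _ = sym (m+[n∸m]≡n (m/n*n≤m x (suc f)))

divN-rem< : ∀ x f → 1 ≤ f → x ∸ divN x f * f < f
divN-rem< x (suc f) _ = subst (_< suc f) (m%n≡m∸m/n*n x (suc f)) (m%n<n x (suc f))

divN-unique : ∀ d r f → r < f → divN (d * f + r) f ≡ d
divN-unique d r (suc f) r<f = begin
  (d * suc f + r) / suc f       ≡⟨ cong (_/ suc f) (+-comm (d * suc f) r) ⟩
  (r + d * suc f) / suc f       ≡⟨ +-distrib-/-∣ʳ r (n∣m*n d) ⟩
  r / suc f + d * suc f / suc f ≡⟨ cong₂ _+_ (m<n⇒m/n≡0 r<f) (m*n/n≡m d (suc f)) ⟩
  d ∎
  where open ≡-Reasoning

iter : (ℕ → ℕ) → ℕ → ℕ → ℕ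
iter f zero    x = x
iter f (suc j) x = iter f j (f x)


iter-outer : ∀ f j x → iter f j (f x) ≡ f (iter f j x)
iter-outer f zero    x = refl
iter-outer f (suc j) x = iter-outer f j (f x)

iter-suc : ∀ j s → iter suc j s ≡ s + j
iter-suc zero    s = sym (+-identityʳ s)
iter-suc (suc j) s = trans (iter-suc j (suc s)) (sym (+-suc s j))

LexLeq : (ℕ → ℕ) → (ℕ → ℕ) → Set
LexLeq a b = ∀ j → (∀ i → i < j → a i ≡ b i) → a j ≤ b j

LexLeq-tail : ∀ {a b} → LexLeq a b → a 0 ≡ b 0 → LexLeq (λ j → a (suc j)) (λ j → b (suc j))
LexLeq-tail a≤b eq j agree = a≤b (suc j) λ { zero _ → eq ; (suc i) (s≤s i<j) → agree i i<j }

LexLess⇒LexLeq : ∀ {a b} → LexLess a b → LexLeq a b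
LexLess⇒LexLeq (j₀ , agree , a<b) j agree′ with <-cmp j j₀
... | tri< j<j₀ _ _ = ≤-reflexive (agree j j<j₀)
... | tri≈ _ refl _ = <⇒≤ a<b
... | tri> _ _ j₀<j = contradiction (agree′ j₀ j₀<j) (<⇒≢ a<b)

LexLeq-cong : ∀ {a a′ b b′} → (∀ j → a j ≡ a′ j) → (∀ j → b j ≡ b′ j) → LexLeq a′ b′ → LexLeq a b
LexLeq-cong a≡ b≡ a′≤b′ j agree = subst₂ _≤_ (sym (a≡ j)) (sym (b≡ j))
  (a′≤b′ j λ i i<j → trans (sym (a≡ i)) (trans (agree i i<j) (b≡ i)))

LexLeq-zero : ∀ {a b} → LexLeq a b → (∀ j → b j ≡ 0) → ∀ i → a i ≡ 0
LexLeq-zero {a} a≤b b≡0 i = below (suc i) i ≤-refl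
  where
  below : ∀ j i → i < j → a i ≡ 0
  below (suc j) i i<1+j with m≤n⇒m<n∨m≡n (≤-pred i<1+j)
  ... | inj₁ i<j  = below j i i<j
  ... | inj₂ refl = n≤0⇒n≡0 (subst (a i ≤_) (b≡0 i) (a≤b i λ i′ i′<i → trans (below i i′ i′<i) (sym (b≡0 i′))))

Prefix : Word → Word → Set
Prefix u v = ∃[ s ] v ≡ u ++ s

prefix-trans : ∀ {u v w} → Prefix u v → Prefix v w → Prefix u w
prefix-trans {u} (s , refl) (t , refl) = s ++ t , ++-assoc u s t

≤-*-left : ∀ {a} n → 1 ≤ a → n ≤ a * n
≤-*-left n 1≤a = ≤-trans (≤-reflexive (sym (*-identityˡ n))) (*-monoˡ-≤ n 1≤a)

module _ (f : Word → Word) (f-[] : f [] ≡ [])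
         (f-++ : ∀ xs ys → f (xs ++ ys) ≡ f xs ++ f ys) where

  f-concat-refined : (π : Word × Word → Word) (D : Word × Word → List (Word × Word)) (Z : List (Word × Word))
    → (∀ pr → pr ∈ Z → concat (map π (D pr)) ≡ f (π pr))
    → concat (map π (concatMap D Z)) ≡ f (concat (map π Z))
  f-concat-refined π D []       _  = sym f-[]
  f-concat-refined π D (pr ∷ Z) hD = begin
    concat (map π (D pr ++ concatMap D Z))
      ≡⟨ cong concat (map-++ π (D pr) _) ⟩
    concat (map π (D pr) ++ map π (concatMap D Z))
      ≡⟨ concat-++ (map π (D pr)) _ ⟨
    concat (map π (D pr)) ++ concat (map π (concatMap D Z))
      ≡⟨ cong₂ _++_ (hD pr (here refl)) (f-concat-refined π D Z (λ q q∈ → hD q (there q∈))) ⟩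
    f (π pr) ++ f (concat (map π Z))
      ≡⟨ f-++ (π pr) _ ⟨
    f (concat (map π (pr ∷ Z))) ∎
    where open ≡-Reasoning

  IsCoDec-image : ∀ v w Z (D : Word × Word → List (Word × Word))
    → IsCoDec v w Z
    → (∀ pr → pr ∈ Z → IsCoDec (f (proj₁ pr)) (f (proj₂ pr)) (D pr))
    → IsCoDec (f v) (f w) (concatMap D Z)
  IsCoDec-image v w []       D (() , _) hD
  IsCoDec-image v w (pr ∷ Z) D (_ , _ , refl , refl) hD =
    first-nonempty , pieces (pr ∷ Z) (λ q q∈ → proj₁ (proj₂ (hD q q∈))) ,
    f-concat-refined proj₁ D (pr ∷ Z) (λ q q∈ → proj₁ (proj₂ (proj₂ (hD q q∈)))) ,
    f-concat-refined proj₂ D (pr ∷ Z) (λ q q∈ → proj₂ (proj₂ (proj₂ (hD q q∈))))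
    where
    first-nonempty : 1 ≤ length (D pr ++ concatMap D Z)
    first-nonempty = ≤-trans (proj₁ (hD pr (here refl))) (≤-trans (m≤m+n _ _) (≤-reflexive (sym (length-++ (D pr)))))
    pieces : ∀ {P : Word × Word → Set} Y → (∀ q → q ∈ Y → All P (D q)) → All P (concatMap D Y)
    pieces []       _  = []
    pieces (q ∷ Y) hP = ++⁺ (hP q (here refl)) (pieces Y (λ q′ q′∈ → hP q′ (there q′∈)))

module Iterates (sh : Shape) (α : ℕ → ℕ) where

  Φ : Word → Word
  Φ = φw sh α

  Φ^ : ℕ → Word → Word
  Φ^ = φ^ sh α

  Φ^-[] : ∀ j → Φ^ j [] ≡ []
  Φ^-[] zero    = refl
  Φ^-[] (suc j) = cong Φ (Φ^-[] j)

  Φ^-++ : ∀ j xs ys → Φ^ j (xs ++ ys) ≡ Φ^ j xs ++ Φ^ j ys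
  Φ^-++ zero    xs ys = refl
  Φ^-++ (suc j) xs ys = trans (cong Φ (Φ^-++ j xs ys)) (concatMap-++ (φ sh α) (Φ^ j xs) (Φ^ j ys))

  Φ^-+ : ∀ k j w → Φ^ (k + j) w ≡ Φ^ k (Φ^ j w)
  Φ^-+ zero    j w = refl
  Φ^-+ (suc k) j w = cong Φ (Φ^-+ k j w)

  Φ^-suc : ∀ j w → Φ^ (suc j) w ≡ Φ^ j (Φ w)
  Φ^-suc zero    w = refl
  Φ^-suc (suc j) w = cong Φ (Φ^-suc j w)

  Φ^-replicate : ∀ j c x → Φ^ j (replicate c x) ≡ pow c (Φ^ j [ x ])
  Φ^-replicate j zero    x = Φ^-[] j
  Φ^-replicate j (suc c) x = trans (Φ^-++ j [ x ] (replicate c x)) (cong (Φ^ j [ x ] ++_) (Φ^-replicate j c x))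

  Φ^-pow : ∀ j c w → Φ^ j (pow c w) ≡ pow c (Φ^ j w)
  Φ^-pow j zero    w = Φ^-[] j
  Φ^-pow j (suc c) w = trans (Φ^-++ j w (pow c w)) (cong (Φ^ j w ++_) (Φ^-pow j c w))

  length-Φ^-++ : ∀ j xs ys → length (Φ^ j (xs ++ ys)) ≡ length (Φ^ j xs) + length (Φ^ j ys)
  length-Φ^-++ j xs ys = trans (cong length (Φ^-++ j xs ys)) (length-++ (Φ^ j xs))

  length-Φ^-block : ∀ k j c → length (Φ^ k (pow c (Φ^ j [ 0 ]))) ≡ c * F sh α (j + k)
  length-Φ^-block k j c = begin
    length (Φ^ k (pow c (Φ^ j [ 0 ])))   ≡⟨ cong length (Φ^-pow k c _) ⟩
    length (pow c (Φ^ k (Φ^ j [ 0 ])))   ≡⟨ length-pow c _ ⟩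
    c * length (Φ^ k (Φ^ j [ 0 ]))       ≡⟨ cong (λ w → c * length w) (Φ^-+ k j [ 0 ]) ⟨
    c * F sh α (k + j)                   ≡⟨ cong (λ i → c * F sh α i) (+-comm k j) ⟩
    c * F sh α (j + k) ∎
    where open ≡-Reasoning

  greedyWord : ℕ → ℕ → Word
  greedyWord zero    x = []
  greedyWord (suc j) x = pow (divN x (F sh α j)) (Φ^ j [ 0 ]) ++ greedyWord j (x ∸ divN x (F sh α j) * F sh α j)

  length-greedy : ∀ N x → length (greedy sh α N x) ≡ suc N
  length-greedy zero    x = refl
  length-greedy (suc N) x = cong suc (length-greedy N _)

  length-Φ^-greedyWord : ∀ k N x → length (Φ^ k (greedyWord (suc N) x)) ≡ valueShift sh α k (greedy sh α N x)
  length-Φ^-greedyWord k zero x = begin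
    length (Φ^ k (pow d (Φ^ 0 [ 0 ]) ++ []))                 ≡⟨ length-Φ^-++ k (pow d (Φ^ 0 [ 0 ])) [] ⟩
    length (Φ^ k (pow d (Φ^ 0 [ 0 ]))) + length (Φ^ k [])    ≡⟨ cong₂ _+_ (length-Φ^-block k 0 d) (cong length (Φ^-[] k)) ⟩
    d * F sh α k + 0 ∎
    where
    open ≡-Reasoning
    d = divN x (F sh α 0)
  length-Φ^-greedyWord k (suc N) x = begin
    length (Φ^ k (pow d (Φ^ (suc N) [ 0 ]) ++ greedyWord (suc N) r))
      ≡⟨ length-Φ^-++ k (pow d (Φ^ (suc N) [ 0 ])) (greedyWord (suc N) r) ⟩
    length (Φ^ k (pow d (Φ^ (suc N) [ 0 ]))) + length (Φ^ k (greedyWord (suc N) r))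
      ≡⟨ cong₂ _+_ (length-Φ^-block k (suc N) d) (length-Φ^-greedyWord k N r) ⟩
    d * F sh α (suc N + k) + valueShift sh α k (greedy sh α N r)
      ≡⟨ cong (λ i → d * F sh α (i + k) + valueShift sh α k (greedy sh α N r)) (length-greedy N r) ⟨
    d * F sh α (length (greedy sh α N r) + k) + valueShift sh α k (greedy sh α N r) ∎
    where
    open ≡-Reasoning
    d = divN x (F sh α (suc N))
    r = x ∸ d * F sh α (suc N)

-- A state ℓ carries the word stateWord ℓ
-- (the letter ℓ, or nothing for the dead states ℓ ≥ m of a simple
-- substitution), and one application of φ turns it into 0^(expo ℓ) followed
-- by the word of the successor state next ℓ.

expo : Shape → (ℕ → ℕ) → ℕ → ℕ
expo (simple m)      α = finSeq m α
expo (nonSimple m p) α = α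

next : Shape → ℕ → ℕ
next (simple m)      ℓ = suc ℓ
next (nonSimple m p) ℓ with suc ℓ <? size (nonSimple m p)
... | yes _ = suc ℓ
... | no  _ = m

stateWord : Shape → ℕ → Word
stateWord (simple m) ℓ with ℓ <? m
... | yes _ = [ ℓ ]
... | no  _ = []
stateWord (nonSimple m p) ℓ = [ ℓ ]

φ-inner : ∀ sh α ℓ → suc ℓ < size sh → φ sh α ℓ ≡ replicate (α ℓ) 0 ++ [ suc ℓ ]
φ-inner sh α ℓ h with suc ℓ <? size sh
... | yes _ = refl
... | no ¬h = contradiction h ¬h

φ-last : ∀ sh α ℓ → ¬ (suc ℓ < size sh) → φ sh α ℓ ≡ replicate (α ℓ) 0 ++ lastTail sh
φ-last sh α ℓ ¬h with suc ℓ <? size sh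
... | yes h = contradiction h ¬h
... | no  _ = refl

φw-step : ∀ sh α ℓ → φw sh α (stateWord sh ℓ) ≡ replicate (expo sh α ℓ) 0 ++ stateWord sh (next sh ℓ)
φw-step (simple m) α ℓ with ℓ <? m | suc ℓ <? m
... | yes _ | yes h  = trans (++-identityʳ _) (φ-inner (simple m) α ℓ h)
... | yes _ | no ¬h  = trans (++-identityʳ _) (φ-last (simple m) α ℓ ¬h)
... | no  _ | no  _  = refl
... | no ¬h | yes h  = contradiction (<⇒≤ h) ¬h
φw-step (nonSimple m p) α ℓ with suc ℓ <? size (nonSimple m p)
... | yes _ = ++-identityʳ _
... | no  _ = ++-identityʳ _

module Automaton (sh : Shape) (α : ℕ → ℕ) where
  open Iterates sh α public

  expansion : ℕ → ℕ → ℕ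
  expansion s j = expo sh α (iter (next sh) j s)

  lenState : ℕ → ℕ → ℕ
  lenState j ℓ = length (Φ^ j (stateWord sh ℓ))

  Φ^-step : ∀ j ℓ → Φ^ (suc j) (stateWord sh ℓ)
                   ≡ pow (expo sh α ℓ) (Φ^ j [ 0 ]) ++ Φ^ j (stateWord sh (next sh ℓ))
  Φ^-step j ℓ = begin
    Φ^ (suc j) (stateWord sh ℓ)
      ≡⟨ Φ^-suc j _ ⟩
    Φ^ j (Φ (stateWord sh ℓ))
      ≡⟨ cong (Φ^ j) (φw-step sh α ℓ) ⟩
    Φ^ j (replicate (expo sh α ℓ) 0 ++ stateWord sh (next sh ℓ))
      ≡⟨ Φ^-++ j _ _ ⟩
    Φ^ j (replicate (expo sh α ℓ) 0) ++ Φ^ j (stateWord sh (next sh ℓ))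
      ≡⟨ cong (_++ Φ^ j (stateWord sh (next sh ℓ))) (Φ^-replicate j (expo sh α ℓ) 0) ⟩
    pow (expo sh α ℓ) (Φ^ j [ 0 ]) ++ Φ^ j (stateWord sh (next sh ℓ)) ∎
    where open ≡-Reasoning

  lenState-step : ∀ j ℓ → lenState (suc j) ℓ ≡ expo sh α ℓ * F sh α j + lenState j (next sh ℓ)
  lenState-step j ℓ = begin
    lenState (suc j) ℓ
      ≡⟨ cong length (Φ^-step j ℓ) ⟩
    length (pow (expo sh α ℓ) (Φ^ j [ 0 ]) ++ Φ^ j (stateWord sh (next sh ℓ)))
      ≡⟨ length-++ (pow (expo sh α ℓ) (Φ^ j [ 0 ])) ⟩
    length (pow (expo sh α ℓ) (Φ^ j [ 0 ])) + lenState j (next sh ℓ)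
      ≡⟨ cong (_+ lenState j (next sh ℓ)) (length-pow (expo sh α ℓ) (Φ^ j [ 0 ])) ⟩
    expo sh α ℓ * F sh α j + lenState j (next sh ℓ) ∎
    where open ≡-Reasoning

-- States whose runs are governed by the Parry condition: all states of a
-- simple substitution, the letters of a non-simple one.
Tracked : Shape → ℕ → Set
Tracked (simple m)      ℓ = ⊤
Tracked (nonSimple m p) ℓ = ℓ < m + p

-- What the rest of the proof uses about a Parry substitution, phrased on the
-- automaton.  `dominated` is the Parry condition itself: every run from a
-- tracked state s ≥ 1 is lexicographically below the run from 0.
record Admissible (sh : Shape) (α : ℕ → ℕ) : Set where
  open Automaton sh α using (expansion)
  field
    word-0       : stateWord sh 0 ≡ [ 0 ]
    tracked-0    : Tracked sh 0
    tracked-next : ∀ ℓ → Tracked sh ℓ → Tracked sh (next sh ℓ)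
    next-pos     : ∀ ℓ → 1 ≤ next sh ℓ
    dominated    : ∀ s → Tracked sh s → 1 ≤ s → LexLeq (expansion s) (expansion 0)
    word-≤1      : ∀ ℓ → length (stateWord sh ℓ) ≤ 1
    word-mono    : ∀ x y → LexLeq (expansion x) (expansion y) → length (stateWord sh x) ≤ length (stateWord sh y)
    live-word    : ∀ ℓ → ℓ < size sh → 1 ≤ length (stateWord sh ℓ)
    live-next    : ∀ ℓ → ℓ < size sh → next sh ℓ < size sh ⊎ 1 ≤ expo sh α ℓ
    expo-0-pos   : 1 ≤ expo sh α 0
    growth       : 2 ≤ expo sh α 0 ⊎ next sh 0 < size sh

module Consequences (sh : Shape) (α : ℕ → ℕ) (adm : Admissible sh α) where
  open Automaton sh α
  open Admissible adm

  lenState-0 : ∀ j → lenState j 0 ≡ F sh α j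
  lenState-0 j = cong (λ w → length (Φ^ j w)) word-0

  -- φ^i(0) is a prefix of φ^(i+1)(0), since φ(0) begins with 0.
  Φ^-prefix-suc : ∀ i → Prefix (Φ^ i [ 0 ]) (Φ^ (suc i) [ 0 ])
  Φ^-prefix-suc i = pow (expo sh α 0 ∸ 1) B ++ T , (begin
    Φ^ (suc i) [ 0 ]                          ≡⟨ cong (Φ^ (suc i)) word-0 ⟨
    Φ^ (suc i) (stateWord sh 0)               ≡⟨ Φ^-step i 0 ⟩
    pow (expo sh α 0) B ++ T                  ≡⟨ cong (λ c → pow c B ++ T) (m+[n∸m]≡n expo-0-pos) ⟨
    (B ++ pow (expo sh α 0 ∸ 1) B) ++ T       ≡⟨ ++-assoc B _ T ⟩
    B ++ pow (expo sh α 0 ∸ 1) B ++ T ∎)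
    where
    open ≡-Reasoning
    B = Φ^ i [ 0 ]
    T = Φ^ i (stateWord sh (next sh 0))

  Φ^-prefix : ∀ i j → i ≤ j → Prefix (Φ^ i [ 0 ]) (Φ^ j [ 0 ])
  Φ^-prefix i j i≤j = subst (λ j → Prefix (Φ^ i [ 0 ]) (Φ^ j [ 0 ])) (m∸n+n≡m i≤j) (go (j ∸ i))
    where
    go : ∀ d → Prefix (Φ^ i [ 0 ]) (Φ^ (d + i) [ 0 ])
    go zero    = [] , sym (++-identityʳ _)
    go (suc d) = prefix-trans (go d) (Φ^-prefix-suc (d + i))

  F-mono : ∀ i j → i ≤ j → F sh α i ≤ F sh α j
  F-mono i j i≤j with Φ^-prefix i j i≤j
  ... | s , eq = subst (F sh α i ≤_) (trans (sym (length-++ (Φ^ i [ 0 ]))) (cong length (sym eq))) (m≤m+n _ _)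

  F-pos : ∀ j → 1 ≤ F sh α j
  F-pos j = F-mono 0 j z≤n

  lenState-pos : ∀ j ℓ → ℓ < size sh → 1 ≤ lenState j ℓ
  lenState-pos zero    ℓ live = live-word ℓ live
  lenState-pos (suc j) ℓ live with live-next ℓ live
  ... | inj₁ live′ = subst (1 ≤_) (sym (lenState-step j ℓ))
                       (≤-trans (lenState-pos j (next sh ℓ) live′) (m≤n+m _ _))
  ... | inj₂ 1≤a   = subst (1 ≤_) (sym (lenState-step j ℓ))
                       (≤-trans (≤-trans (F-pos j) (≤-*-left (F sh α j) 1≤a)) (m≤m+n _ _))

  -- F is strictly increasing; in particular F_j > j, so u_[j] is a prefix of φ^j(0).
  F-grow : ∀ j → F sh α j < F sh α (suc j)
  F-grow j = subst (F sh α j <_) (trans (sym (lenState-step j 0)) (lenState-0 (suc j))) (go growth)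
    where
    Fj = F sh α j
    go : 2 ≤ expo sh α 0 ⊎ next sh 0 < size sh → Fj < expo sh α 0 * Fj + lenState j (next sh 0)
    go (inj₁ 2≤a) = ≤-trans (≤-reflexive (+-comm 1 Fj))
                   (≤-trans (+-monoʳ-≤ Fj (≤-trans (F-pos j) (m≤m+n Fj 0)))
                   (≤-trans (*-monoˡ-≤ Fj 2≤a) (m≤m+n _ _)))
    go (inj₂ live) = ≤-trans (≤-reflexive (+-comm 1 Fj))
                             (+-mono-≤ (≤-*-left Fj expo-0-pos) (lenState-pos j (next sh 0) live))

  F-≥ : ∀ j → j < F sh α j
  F-≥ zero    = s≤s z≤n
  F-≥ (suc j) = ≤-trans (s≤s (F-≥ j)) (F-grow j)

  uPrefix-take : ∀ x j → x ≤ F sh α j → uPrefix sh α x ≡ take x (Φ^ j [ 0 ])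
  uPrefix-take x j x≤F with ≤-total x j
  ... | inj₁ x≤j with Φ^-prefix x j x≤j
  ...   | s , eq = sym (trans (cong (take x) eq) (take-++-≤ _ s x (<⇒≤ (F-≥ x))))
  uPrefix-take x j x≤F | inj₂ j≤x with Φ^-prefix j x j≤x
  ...   | s , eq = trans (cong (take x) eq) (take-++-≤ _ s x x≤F)

  lenState-lex : ∀ i x y → Tracked sh x → LexLeq (expansion x) (expansion y) → lenState i x ≤ lenState i y

  lenState-≤-F : ∀ i s → Tracked sh s → 1 ≤ s → lenState i s ≤ F sh α i
  lenState-≤-F i s tr 1≤s = subst (lenState i s ≤_) (lenState-0 i) (lenState-lex i s 0 tr (dominated s tr 1≤s))

  lenState-lex zero    x y _  x≤y = word-mono x y x≤y
  lenState-lex (suc i) x y tr x≤y =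
    subst₂ _≤_ (sym (lenState-step i x)) (sym (lenState-step i y)) (go (m≤n⇒m<n∨m≡n (x≤y 0 λ _ ())))
    where
    Fi = F sh α i
    ax = expo sh α x
    ay = expo sh α y
    go : ax < ay ⊎ ax ≡ ay → ax * Fi + lenState i (next sh x) ≤ ay * Fi + lenState i (next sh y)
    go (inj₁ ax<ay) = ≤-trans (+-monoʳ-≤ (ax * Fi) (lenState-≤-F i (next sh x) (tracked-next x tr) (next-pos x)))
                     (≤-trans (≤-reflexive (+-comm (ax * Fi) Fi))
                     (≤-trans (*-monoˡ-≤ Fi ax<ay) (m≤m+n _ _)))
    go (inj₂ ax≡ay) = +-mono-≤ (≤-reflexive (cong (_* Fi) ax≡ay))
                               (lenState-lex i (next sh x) (next sh y) (tracked-next x tr) (LexLeq-tail x≤y ax≡ay))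

  take-greedyWord : ∀ j ℓ → Tracked sh ℓ → ∀ x → x < lenState j ℓ → take x (Φ^ j (stateWord sh ℓ)) ≡ greedyWord j x
  take-greedyWord zero    ℓ tr zero    _ = refl
  take-greedyWord zero    ℓ tr (suc x) x< with ≤-trans x< (word-≤1 ℓ)
  ... | s≤s ()
  take-greedyWord (suc j) ℓ tr x x< = trans (cong (take x) (Φ^-step j ℓ)) (go (x <? a * Fj))
    where
    open ≡-Reasoning
    Fj = F sh α j
    a = expo sh α ℓ
    B = Φ^ j [ 0 ]
    T = Φ^ j (stateWord sh (next sh ℓ))
    d = divN x Fj
    r = x ∸ d * Fj
    x≡ : x ≡ d * Fj + r
    x≡ = divN-split x Fj (F-pos j)
    r< : r < Fj
    r< = divN-rem< x Fj (F-pos j)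
    go : Dec (x < a * Fj) → take x (pow a B ++ T) ≡ greedyWord (suc j) x
    -- x ends inside the block φ^j(0)^a: the remainder is a prefix of φ^j(0)
    go (yes x<aF) = begin
      take x (pow a B ++ T)              ≡⟨ cong (λ y → take y (pow a B ++ T)) x≡ ⟩
      take (d * Fj + r) (pow a B ++ T)   ≡⟨ take-pow-inside a d B T r d<a (<⇒≤ r<) ⟩
      pow d B ++ take r B                ≡⟨ cong (λ w → pow d B ++ take r (Φ^ j w)) word-0 ⟨
      pow d B ++ take r (Φ^ j (stateWord sh 0))
        ≡⟨ cong (pow d B ++_) (take-greedyWord j 0 tracked-0 r (subst (r <_) (sym (lenState-0 j)) r<)) ⟩
      greedyWord (suc j) x ∎
      where
      d<a : d < a
      d<a = *-cancelʳ-< Fj d a (≤-<-trans (m≤m+n (d * Fj) r) (subst (_< a * Fj) x≡ x<aF))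
    -- x passes the whole block: the greedy digit is exactly a, because the
    -- tail φ^j(stateWord (next ℓ)) is shorter than φ^j(0)
    go (no x≮aF) = begin
      take x (pow a B ++ T)                   ≡⟨ cong (λ y → take y (pow a B ++ T)) x≡′ ⟩
      take (a * Fj + r′) (pow a B ++ T)       ≡⟨ take-pow-++ a B T r′ ⟩
      pow a B ++ take r′ T                    ≡⟨ cong (pow a B ++_) (take-greedyWord j (next sh ℓ) (tracked-next ℓ tr) r′ r′<T) ⟩
      pow a B ++ greedyWord j r′              ≡⟨ cong (λ c → pow c B ++ greedyWord j (x ∸ c * Fj)) d≡a ⟨
      greedyWord (suc j) x ∎
      where
      r′ = x ∸ a * Fj
      x≡′ : x ≡ a * Fj + r′
      x≡′ = sym (m+[n∸m]≡n (≮⇒≥ x≮aF))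
      r′<T : r′ < lenState j (next sh ℓ)
      r′<T = +-cancelˡ-< (a * Fj) r′ _ (subst (_< a * Fj + lenState j (next sh ℓ)) x≡′ (subst (x <_) (lenState-step j ℓ) x<))
      d≡a : d ≡ a
      d≡a = trans (cong (λ y → divN y Fj) x≡′)
                  (divN-unique a r′ Fj (≤-trans r′<T (lenState-≤-F j (next sh ℓ) (tracked-next ℓ tr) (next-pos ℓ))))

  codec-shift : ∀ Q N M → Q < F sh α (suc N) → suc N ≤ M → ∀ k (Z : List (Word × Word))
    → IsCoDec (Φ^ M [ 0 ]) (leftQuot (uPrefix sh α Q) (Φ^ M [ 0 ] ++ uPrefix sh α Q)) Z
    → (D : Word × Word → List (Word × Word))
    → (∀ pr → pr ∈ Z → IsCoDec (Φ^ k (proj₁ pr)) (Φ^ k (proj₂ pr)) (D pr))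
    → let n = valueShift sh α k (greedy sh α N Q) in
      IsCoDec (Φ^ (k + M) [ 0 ]) (leftQuot (uPrefix sh α n) (Φ^ (k + M) [ 0 ] ++ uPrefix sh α n)) (concatMap D Z)
  codec-shift Q N M Q<F N<M k Z hZ D hD =
    subst₂ (λ v w → IsCoDec v w (concatMap D Z)) (sym (Φ^-+ k M [ 0 ])) rotated-image
      (IsCoDec-image (Φ^ k) (Φ^-[] k) (Φ^-++ k) X (leftQuot P (X ++ P)) Z D hZ hD)
    where
    open ≡-Reasoning
    n = valueShift sh α k (greedy sh α N Q)
    X = Φ^ M [ 0 ]
    P = uPrefix sh α Q
    Y = drop Q X
    X≡PY : X ≡ P ++ Y
    X≡PY = trans (sym (take++drop≡id Q X))
                 (cong (_++ Y) (sym (uPrefix-take Q M (≤-trans (<⇒≤ Q<F) (F-mono (suc N) M N<M)))))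
    P≡greedy : P ≡ greedyWord (suc N) Q
    P≡greedy = begin
      P                                            ≡⟨ uPrefix-take Q (suc N) (<⇒≤ Q<F) ⟩
      take Q (Φ^ (suc N) [ 0 ])                    ≡⟨ cong (λ w → take Q (Φ^ (suc N) w)) word-0 ⟨
      take Q (Φ^ (suc N) (stateWord sh 0))         ≡⟨ take-greedyWord (suc N) 0 tracked-0 Q (subst (Q <_) (sym (lenState-0 (suc N))) Q<F) ⟩
      greedyWord (suc N) Q ∎
    n≡ : n ≡ length (Φ^ k P)
    n≡ = trans (sym (length-Φ^-greedyWord k N Q)) (cong (λ w → length (Φ^ k w)) (sym P≡greedy))
    image : Φ^ (k + M) [ 0 ] ≡ Φ^ k P ++ Φ^ k Y
    image = trans (Φ^-+ k M [ 0 ]) (trans (cong (Φ^ k) X≡PY) (Φ^-++ k P Y))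
    u[n]≡ : uPrefix sh α n ≡ Φ^ k P
    u[n]≡ = begin
      uPrefix sh α n                                 ≡⟨ uPrefix-take n (k + M) n≤ ⟩
      take n (Φ^ (k + M) [ 0 ])                      ≡⟨ cong₂ take n≡ image ⟩
      take (length (Φ^ k P)) (Φ^ k P ++ Φ^ k Y)      ≡⟨ take-length-++ (Φ^ k P) (Φ^ k Y) ⟩
      Φ^ k P ∎
      where
      n≤ : n ≤ F sh α (k + M)
      n≤ = subst₂ _≤_ (sym n≡) (sym (trans (cong length image) (length-++ (Φ^ k P)))) (m≤m+n _ _)
    rotated-image : Φ^ k (leftQuot P (X ++ P)) ≡ leftQuot (uPrefix sh α n) (Φ^ (k + M) [ 0 ] ++ uPrefix sh α n)
    rotated-image = begin
      Φ^ k (drop (length P) (X ++ P))                          ≡⟨ cong (λ x → Φ^ k (drop (length P) (x ++ P))) X≡PY ⟩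
      Φ^ k (drop (length P) ((P ++ Y) ++ P))                   ≡⟨ cong (Φ^ k) (leftQuot-rotate P Y) ⟩
      Φ^ k (Y ++ P)                                            ≡⟨ Φ^-++ k Y P ⟩
      Φ^ k Y ++ Φ^ k P                                         ≡⟨ leftQuot-rotate (Φ^ k P) (Φ^ k Y) ⟨
      drop (length (Φ^ k P)) ((Φ^ k P ++ Φ^ k Y) ++ Φ^ k P)    ≡⟨ cong₂ (λ u x → drop (length u) (x ++ u)) u[n]≡ image ⟨
      drop (length (uPrefix sh α n)) (Φ^ (k + M) [ 0 ] ++ uPrefix sh α n) ∎

assocConst-α0 : ∀ sh α R → AssocConst sh α R → 1 ≤ α 0
assocConst-α0 (simple m)      α R (inj₁ (2≤α0 , _))       = ≤-trans (s≤s z≤n) 2≤α0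
assocConst-α0 (simple m)      α R (inj₂ (α0≡1 , _))       = ≤-reflexive (sym α0≡1)
assocConst-α0 (nonSimple m p) α R (_ , _ , inj₁ (2≤α0 , _)) = ≤-trans (s≤s z≤n) 2≤α0
assocConst-α0 (nonSimple m p) α R (_ , _ , inj₂ (α0≡1 , _)) = ≤-reflexive (sym α0≡1)

finSeq-in : ∀ m α i → i < m → finSeq m α i ≡ α i
finSeq-in m α i i<m with i <? m
... | yes _ = refl
... | no i≮m = contradiction i<m i≮m

finSeq-out : ∀ m α i → ¬ (i < m) → finSeq m α i ≡ 0
finSeq-out m α i i≮m with i <? m
... | yes i<m = contradiction i<m i≮m
... | no _ = refl

-- (Written for m = m′ + 1; the alphabet of a simple substitution is nonempty.)
module SimpleParry (m′ : ℕ) (α : ℕ → ℕ) where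
  m : ℕ
  m = suc m′

  open Automaton (simple m) α using (expansion)

  expansion-simple : ∀ s j → expansion s j ≡ finSeq m α (s + j)
  expansion-simple s j = cong (finSeq m α) (iter-suc j s)

  expansion-dead : ∀ s → ¬ (s < m) → ∀ j → expansion s j ≡ 0
  expansion-dead s s≮m j = trans (expansion-simple s j)
    (finSeq-out m α (s + j) λ s+j<m → s≮m (≤-<-trans (m≤m+n s j) s+j<m))

  admissible : ∀ R → IsParry (simple m) α → AssocConst (simple m) α R → Admissible (simple m) α
  admissible R (_ , 1≤αlast , parry , _) ac = record
    { word-0       = refl
    ; tracked-0    = tt
    ; tracked-next = λ _ _ → tt
    ; next-pos     = λ _ → s≤s z≤n
    ; dominated    = dominated
    ; word-≤1      = word-≤1
    ; word-mono    = word-mono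
    ; live-word    = live-word
    ; live-next    = live-next
    ; expo-0-pos   = assocConst-α0 (simple m) α R ac
    ; growth       = growth ac
    }
    where
    dominated : ∀ s → ⊤ → 1 ≤ s → LexLeq (expansion s) (expansion 0)
    dominated s _ 1≤s with s <? m
    ... | yes s<m = LexLeq-cong (expansion-simple s) (expansion-simple 0) (LexLess⇒LexLeq (parry s 1≤s (≤-pred s<m)))
    ... | no s≮m  = λ j _ → subst (_≤ expansion 0 j) (sym (expansion-dead s s≮m j)) z≤n

    word-≤1 : ∀ ℓ → length (stateWord (simple m) ℓ) ≤ 1
    word-≤1 ℓ with ℓ <? m
    ... | yes _ = ≤-refl
    ... | no  _ = z≤n

    -- A live state x is not lexicographically below a dead state y: the run
    -- from x reaches α_(m-1) ≥ 1 while the run from y stays 0.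
    word-mono : ∀ x y → LexLeq (expansion x) (expansion y)
      → length (stateWord (simple m) x) ≤ length (stateWord (simple m) y)
    word-mono x y x≤y with y <? m
    ... | yes _  = word-≤1 x
    ... | no y≮m with x <? m
    ...   | no _    = z≤n
    ...   | yes x<m = contradiction (sym reaches-last) (<⇒≢ 1≤αlast)
      where
      open ≡-Reasoning
      reaches-last : α m′ ≡ 0
      reaches-last = begin
        α m′                         ≡⟨ finSeq-in m α m′ ≤-refl ⟨
        finSeq m α m′                ≡⟨ cong (finSeq m α) (m+[n∸m]≡n (≤-pred x<m)) ⟨
        finSeq m α (x + (m′ ∸ x))    ≡⟨ expansion-simple x _ ⟨
        expansion x (m′ ∸ x)         ≡⟨ LexLeq-zero x≤y (expansion-dead y y≮m) (m′ ∸ x) ⟩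
        0 ∎

    live-word : ∀ ℓ → ℓ < m → 1 ≤ length (stateWord (simple m) ℓ)
    live-word ℓ ℓ<m with ℓ <? m
    ... | yes _  = ≤-refl
    ... | no ℓ≮m = contradiction ℓ<m ℓ≮m

    live-next : ∀ ℓ → ℓ < m → suc ℓ < m ⊎ 1 ≤ finSeq m α ℓ
    live-next ℓ ℓ<m with suc ℓ <? m
    ... | yes 1+ℓ<m = inj₁ 1+ℓ<m
    ... | no 1+ℓ≮m  = inj₂ (subst (1 ≤_) (sym (trans (finSeq-in m α ℓ ℓ<m) (cong α ℓ≡m′))) 1≤αlast)
      where
      ℓ≡m′ : ℓ ≡ m′
      ℓ≡m′ = ≤-antisym (≤-pred ℓ<m) (≤-pred (≮⇒≥ 1+ℓ≮m))

    growth : AssocConst (simple m) α R → 2 ≤ finSeq m α 0 ⊎ 1 < m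
    growth (inj₁ (2≤α0 , _)) = inj₁ 2≤α0
    growth (inj₂ (_ , ℓ′ , ((1≤ℓ′ , ℓ′<m , _) , _) , _)) = inj₂ (≤-<-trans 1≤ℓ′ ℓ′<m)

-- The letter whose exponent is d_i.
periodicIndex : ℕ → ℕ → ℕ → ℕ
periodicIndex m p i with i <? m
... | yes _ = i
... | no  _ = m + modN (i ∸ m) p

perSeq-periodicIndex : ∀ m p α i → perSeq m p α i ≡ α (periodicIndex m p i)
perSeq-periodicIndex m p α i with i <? m
... | yes _ = refl
... | no  _ = refl

%-suc : ∀ x q → suc x % suc q ≡ suc (x % suc q) % suc q
%-suc x q = trans (cong (λ y → suc y % suc q) (m≡m%n+[m/n]*n x (suc q)))
                  ([m+kn]%n≡m%n (suc (x % suc q)) (x / suc q) (suc q))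

module NonSimpleParry (m q : ℕ) (α : ℕ → ℕ) where
  p : ℕ
  p = suc q

  open Automaton (nonSimple m p) α using (expansion)

  next-in : ∀ ℓ → suc ℓ < m + p → next (nonSimple m p) ℓ ≡ suc ℓ
  next-in ℓ h with suc ℓ <? size (nonSimple m p)
  ... | yes _ = refl
  ... | no ¬h = contradiction h ¬h

  next-wrap : ∀ ℓ → ¬ (suc ℓ < m + p) → next (nonSimple m p) ℓ ≡ m
  next-wrap ℓ ¬h with suc ℓ <? size (nonSimple m p)
  ... | yes h = contradiction h ¬h
  ... | no  _ = refl

  next-bounded : ∀ ℓ → ℓ < m + p → next (nonSimple m p) ℓ < m + p
  next-bounded ℓ ℓ< with suc ℓ <? size (nonSimple m p)
  ... | yes 1+ℓ< = 1+ℓ<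
  ... | no  _    = subst (m <_) (sym (+-suc m q)) (s≤s (m≤m+n m q))

  next-pos : ∀ ℓ → 1 ≤ m → 1 ≤ next (nonSimple m p) ℓ
  next-pos ℓ 1≤m with suc ℓ <? size (nonSimple m p)
  ... | yes _ = s≤s z≤n
  ... | no  _ = 1≤m

  periodicIndex-letter : ∀ s → s < m + p → periodicIndex m p s ≡ s
  periodicIndex-letter s s< with s <? m
  ... | yes _  = refl
  ... | no s≮m = trans (cong (m +_) (m<n⇒m%n≡m s∸m<p)) (m+[n∸m]≡n (≮⇒≥ s≮m))
    where
    s∸m<p : s ∸ m < p
    s∸m<p = +-cancelˡ-< m (s ∸ m) p (subst (_< m + p) (sym (m+[n∸m]≡n (≮⇒≥ s≮m))) s<)

  periodicIndex-periodic : ∀ i → ¬ (i < m) → periodicIndex m p i ≡ m + (i ∸ m) % p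
  periodicIndex-periodic i i≮m with i <? m
  ... | yes i<m = contradiction i<m i≮m
  ... | no  _   = refl

  next-periodicIndex : ∀ i → next (nonSimple m p) (periodicIndex m p i) ≡ periodicIndex m p (suc i)
  next-periodicIndex i with i <? m
  ... | yes i<m = trans (next-in i 1+i<) (sym (periodicIndex-letter (suc i) 1+i<))
    where
    1+i< : suc i < m + p
    1+i< = subst (suc (suc i) ≤_) (sym (+-suc m q)) (s≤s (≤-trans i<m (m≤m+n m q)))
  ... | no  i≮m = trans (step (suc r <? p)) (sym (trans (periodicIndex-periodic (suc i) (i≮m ∘ <⇒≤))
                                                        (cong (λ y → m + y % p) (+-∸-assoc 1 (≮⇒≥ i≮m)))))
    where
    r = (i ∸ m) % p
    step : Dec (suc r < p) → next (nonSimple m p) (m + r) ≡ m + suc (i ∸ m) % p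
    step (yes 1+r<p) = begin
      next (nonSimple m p) (m + r)  ≡⟨ next-in (m + r) (subst (_< m + p) (+-suc m r) (+-monoʳ-< m 1+r<p)) ⟩
      suc (m + r)                   ≡⟨ +-suc m r ⟨
      m + suc r                     ≡⟨ cong (m +_) (m<n⇒m%n≡m 1+r<p) ⟨
      m + suc r % p                 ≡⟨ cong (m +_) (%-suc (i ∸ m) q) ⟨
      m + suc (i ∸ m) % p ∎
      where open ≡-Reasoning
    step (no 1+r≮p) = begin
      next (nonSimple m p) (m + r)  ≡⟨ next-wrap (m + r) (λ h → 1+r≮p (+-cancelˡ-< m (suc r) p (subst (_< m + p) (sym (+-suc m r)) h))) ⟩
      m                             ≡⟨ +-identityʳ m ⟨
      m + 0                         ≡⟨ cong (m +_) (n%n≡0 p) ⟨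
      m + p % p                     ≡⟨ cong (λ y → m + y % p) 1+r≡p ⟨
      m + suc r % p                 ≡⟨ cong (m +_) (%-suc (i ∸ m) q) ⟨
      m + suc (i ∸ m) % p ∎
      where
      open ≡-Reasoning
      1+r≡p : suc r ≡ p
      1+r≡p = ≤-antisym (m%n<n (i ∸ m) p) (≮⇒≥ 1+r≮p)

  iter-next : ∀ s → s < m + p → ∀ j → iter (next (nonSimple m p)) j s ≡ periodicIndex m p (s + j)
  iter-next s s< zero    = sym (trans (cong (periodicIndex m p) (+-identityʳ s)) (periodicIndex-letter s s<))
  iter-next s s< (suc j) = begin
    iter (next (nonSimple m p)) j (next (nonSimple m p) s)   ≡⟨ iter-outer (next (nonSimple m p)) j s ⟩
    next (nonSimple m p) (iter (next (nonSimple m p)) j s)   ≡⟨ cong (next (nonSimple m p)) (iter-next s s< j) ⟩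
    next (nonSimple m p) (periodicIndex m p (s + j))         ≡⟨ next-periodicIndex (s + j) ⟩
    periodicIndex m p (suc (s + j))                          ≡⟨ cong (periodicIndex m p) (+-suc s j) ⟨
    periodicIndex m p (s + suc j) ∎
    where open ≡-Reasoning

  expansion-nonSimple : ∀ s → s < m + p → ∀ j → expansion s j ≡ perSeq m p α (s + j)
  expansion-nonSimple s s< j = trans (cong α (iter-next s s< j)) (sym (perSeq-periodicIndex m p α (s + j)))

  admissible : ∀ R → IsParry (nonSimple m p) α → AssocConst (nonSimple m p) α R → Admissible (nonSimple m p) α
  admissible R (1≤m , _ , _ , _ , parry) ac = record
    { word-0       = refl
    ; tracked-0    = 0<m+p
    ; tracked-next = next-bounded
    ; next-pos     = λ ℓ → next-pos ℓ 1≤m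
    ; dominated    = λ s s< 1≤s → LexLeq-cong (expansion-nonSimple s s<) (expansion-nonSimple 0 0<m+p)
                                              (LexLess⇒LexLeq (parry s 1≤s))
    ; word-≤1      = λ _ → ≤-refl
    ; word-mono    = λ _ _ _ → ≤-refl
    ; live-word    = λ _ _ → ≤-refl
    ; live-next    = λ ℓ ℓ< → inj₁ (next-bounded ℓ ℓ<)
    ; expo-0-pos   = assocConst-α0 (nonSimple m p) α R ac
    ; growth       = inj₂ (next-bounded 0 0<m+p)
    }
    where
    0<m+p : 0 < m + p
    0<m+p = ≤-trans 1≤m (m≤m+n m p)

-- Every Parry substitution is admissible (the empty alphabet and the period
-- p = 0 are excluded by IsParry).
parry-admissible : ∀ sh α R → IsParry sh α → AssocConst sh α R → Admissible sh α
parry-admissible (simple zero)     α R (() , _)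
parry-admissible (simple (suc m′)) α R = SimpleParry.admissible m′ α R
parry-admissible (nonSimple m zero)    α R (_ , () , _)
parry-admissible (nonSimple m (suc q)) α R = NonSimpleParry.admissible m q α R

-- The exponent N + 1 + R is at least N + 1.
corollary5p3 : (sh : Shape) (α : ℕ → ℕ) → IsParry sh α
    → (R : ℕ) → AssocConst sh α R
    → (Q N : ℕ) → Q < F sh α (suc N)
    → (k : ℕ) → 1 ≤ k
    → (Z : List (Word × Word))
    → IsCoDec (φ^ sh α (suc N + R) [ 0 ])
              (leftQuot (uPrefix sh α Q) (φ^ sh α (suc N + R) [ 0 ] ++ uPrefix sh α Q)) Z
    → (D : Word × Word → List (Word × Word))
    → (∀ pr → pr ∈ Z → IsCoDec (φ^ sh α k (proj₁ pr)) (φ^ sh α k (proj₂ pr)) (D pr))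
    → IsCoDec (φ^ sh α (k + (suc N + R)) [ 0 ])
              (leftQuot (uPrefix sh α (valueShift sh α k (greedy sh α N Q)))
                        (φ^ sh α (k + (suc N + R)) [ 0 ] ++ uPrefix sh α (valueShift sh α k (greedy sh α N Q))))
              (concatMap D Z)
corollary5p3 sh α parry R ac Q N Q<F k _ =
  Consequences.codec-shift sh α (parry-admissible sh α R parry ac) Q N (suc N + R) Q<F (m≤m+n (suc N) R) k
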